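{- For all integers $n,k\ge0$, $\sum_{\lambda\in\mathcal{T}_n^k}x^{w_{\mathcal{T}}^{\leftarrow}(\lambda)}=\widehat{\mathscr{B}}_n^k(x)$.
   Context: $\widehat{\mathscr{B}}_n^k(x)=\sum_{j=0}^{\min(n,k)} j!\,(x+1)(x+2)\cdots(x+j)\,S(n+1,j+1)\,S(k+1,j+1)$ with $S(\cdot,\cdot)$ the Stirling numbers of the second kind. For $n,k\ge1$, $\mathcal{T}_n^k$ is the set of alternative tableaux of rectangular shape $n\times k$: partial fillings of the cells of an $n\times k$ rectangle with left arrows $\leftarrow$ and down arrows $\downarrow$ such that every cell pointed to by an arrow (every cell strictly left of a $\leftarrow$ in its row, or strictly below a $\downarrow$ in its column) is empty. If $n=0$ or $k=0$, $\mathcal{T}_n^k$ consists of a single empty tableau. $w_{\mathcal{T}}^{\leftarrow}(\lambda)$ is the number of columns of $\lambda$ that contain a $\leftarrow$ but no $\downarrow$. -}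

module Defs where

open import Level using (Level)
open import Data.Bool using (Bool; true; false; _∧_; _∨_; not; if_then_else_)
open import Data.Nat using (ℕ; zero; suc; _<ᵇ_; _⊓_; _!)
import Data.Nat as ℕ
open import Data.Fin using (Fin; toℕ)
open import Data.List using (List; []; _∷_; map; concatMap; allFin; foldr; upTo; filter)
open import Data.Bool.ListAction using (all; any)
open import Data.Vec using (Vec; []; _∷_; lookup)
open import Algebra.Bundles using (CommutativeSemiring)

S : ℕ → ℕ → ℕ
S zero    zero    = 1
S zero    (suc k) = 0
S (suc n) zero    = 0
S (suc n) (suc k) = suc k ℕ.* S n (suc k) ℕ.+ S n k

-- Alternative tableaux of rectangular shape n × k
-- A filling is a Vec of n rows, each a Vec of k cells.
-- Row index i increases downward, column index j increases to the right.

data Cell : Set where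
  empty left down : Cell

isEmpty : Cell → Bool
isEmpty empty = true
isEmpty left  = false
isEmpty down  = false

isLeft : Cell → Bool
isLeft left = true
isLeft _    = false

isDown : Cell → Bool
isDown down = true
isDown _    = false

Filling : ℕ → ℕ → Set
Filling n k = Vec (Vec Cell k) n

allVecs : {A : Set} → List A → (m : ℕ) → List (Vec A m)
allVecs xs zero    = [] ∷ []
allVecs xs (suc m) = concatMap (λ a → map (a ∷_) (allVecs xs m)) xs

allCells : List Cell
allCells = empty ∷ left ∷ down ∷ []

allFillings : (n k : ℕ) → List (Filling n k)
allFillings n k = allVecs (allVecs allCells k) n

cellAt : ∀ {n k} → Filling n k → Fin n → Fin k → Cell
cellAt T i j = lookup (lookup T i) j

okCell : ∀ {n k} → Filling n k → Fin n → Fin k → Cell → Bool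
okCell {n} {k} T i j empty = true
okCell {n} {k} T i j left  =
  all (λ j' → not (toℕ j' <ᵇ toℕ j) ∨ isEmpty (cellAt T i j')) (allFin k)
okCell {n} {k} T i j down  =
  all (λ i' → not (toℕ i <ᵇ toℕ i') ∨ isEmpty (cellAt T i' j)) (allFin n)

isAltTableau : ∀ {n k} → Filling n k → Bool
isAltTableau {n} {k} T =
  all (λ i → all (λ j → okCell T i j (cellAt T i j)) (allFin k)) (allFin n)

altTableaux : (n k : ℕ) → List (Filling n k)
altTableaux n k = filter (λ T → isAltTableau T Data.Bool.≟ true) (allFillings n k)
  where import Data.Bool

count : {A : Set} → (A → Bool) → List A → ℕ
count p []       = 0
count p (a ∷ as) = if p a then suc (count p as) else count p as

wLeft : ∀ {n k} → Filling n k → ℕ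
wLeft {n} {k} T =
  count (λ j → any (λ i → isLeft (cellAt T i j)) (allFin n)
               ∧ not (any (λ i → isDown (cellAt T i j)) (allFin n)))
        (allFin k)

-- Polynomial expressions, evaluated at an arbitrary element x of an
-- arbitrary commutative semiring (an identity of ℕ[x]-polynomials holds
-- iff it holds for all such evaluations).

module Poly {c ℓ : Level} (R : CommutativeSemiring c ℓ) where
  open CommutativeSemiring R

  fromℕ : ℕ → Carrier
  fromℕ zero    = 0#
  fromℕ (suc m) = 1# + fromℕ m

  pow : Carrier → ℕ → Carrier
  pow x zero    = 1#
  pow x (suc m) = x * pow x m

  sumR : List Carrier → Carrier
  sumR = foldr _+_ 0#

  rising : Carrier → ℕ → Carrier
  rising x zero    = 1#
  rising x (suc j) = rising x j * (x + fromℕ (suc j))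

  tableauPoly : ℕ → ℕ → Carrier → Carrier
  tableauPoly n k x = sumR (map (λ T → pow x (wLeft T)) (altTableaux n k))

  Bhat : ℕ → ℕ → Carrier → Carrier
  Bhat n k x =
    sumR (map (λ j → fromℕ (j !) * rising x j
                       * fromℕ (S (suc n) (suc j) ℕ.* S (suc k) (suc j)))
              (upTo (suc (n ⊓ k))))

-- Appending a column c on the right of an n × k filling T yields an alternative tableau iff
-- T is one, c is one (nothing below a ↓ of c), and T is empty in every row where c has a ←;
-- deleting those empty rows changes neither validity nor w←, and c adds 1 to w← iff it has a
-- ← but no ↓.  Hence t(·, k+1) = L t(·, k) for the linear operator
--   (L f)(n) = Σ_{c valid column of height n} x^[c has ← but no ↓] f(#non-← cells of c).
-- Summing over the shape of c and using the Stirling recurrence, the sequences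
-- β_j(m) = j! (x+1)⋯(x+j) S(m+1, j+1) satisfy L β_j = (j+1) β_j + β_{j+1}.  As t(·, 0) = 1 = β_0,
-- induction on k gives t(n, k) = Σ_j S(k+1, j+1) β_j(n), whose terms with j > min(n, k) vanish.

{-# OPTIONS --safe #-}
module Submission where

open import Defs
open import Data.Nat using (ℕ)
open import Algebra.Bundles using (CommutativeSemiring)

module Tableau where

  open import Function using (_∘_; id)
  open import Data.Bool using (Bool; true; false; _∧_; _∨_; not; if_then_else_)
  open import Data.Bool.Properties using (∧-assoc; ∧-identityʳ; ∧-commutativeMonoid)
  open import Data.Bool.ListAction using (and; or; all; any)
  open import Data.Nat using (zero; suc; _+_; _<ᵇ_)
  open import Data.Fin as Fin using (Fin; toℕ; inject₁; fromℕ)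
  open import Data.Fin.Properties using (toℕ-inject₁)
  open import Data.List as List using (List; []; _∷_; map; tabulate; allFin; _++_)
  open import Data.List.Properties using (map-cong; map-∘; map-tabulate)
  open import Data.Vec as Vec using (Vec; []; _∷_; lookup; _∷ʳ_; replicate; toList)
  open import Data.Vec.Properties using (lookup-map; lookup-replicate)
  open import Relation.Binary.PropositionalEquality
  open import Algebra.Solver.CommutativeMonoid ∧-commutativeMonoid
    using (solve; _⊜_; _⊕_)
  open ≡-Reasoning

  module _ {A : Set} where

    all-cong : {p q : A → Bool} → (∀ a → p a ≡ q a) → ∀ xs → all p xs ≡ all q xs
    all-cong p≗q xs = cong and (map-cong p≗q xs)

    count-cong : {p q : A → Bool} → (∀ a → p a ≡ q a) → ∀ xs → count p xs ≡ count q xs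
    count-cong p≗q []       = refl
    count-cong p≗q (a ∷ xs) rewrite p≗q a | count-cong p≗q xs = refl

    all-map : ∀ {B : Set} (p : A → Bool) (f : B → A) xs → all p (map f xs) ≡ all (p ∘ f) xs
    all-map p f xs = cong and (sym (map-∘ xs))

    count-map : ∀ {B : Set} (p : A → Bool) (f : B → A) xs → count p (map f xs) ≡ count (p ∘ f) xs
    count-map p f []       = refl
    count-map p f (b ∷ xs) rewrite count-map p f xs = refl

    all-++ : ∀ (p : A → Bool) xs ys → all p (xs ++ ys) ≡ all p xs ∧ all p ys
    all-++ p []       ys = refl
    all-++ p (a ∷ xs) ys = trans (cong (p a ∧_) (all-++ p xs ys)) (sym (∧-assoc (p a) _ _))

    count-++ : ∀ (p : A → Bool) xs ys → count p (xs ++ ys) ≡ count p xs + count p ys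
    count-++ p []       ys = refl
    count-++ p (a ∷ xs) ys with p a
    ... | true  = cong suc (count-++ p xs ys)
    ... | false = count-++ p xs ys

    all-const-true : ∀ (xs : List A) → all (λ _ → true) xs ≡ true
    all-const-true []       = refl
    all-const-true (a ∷ xs) = all-const-true xs

    tabulate-∷ʳ : ∀ {n} (f : Fin (suc n) → A) → tabulate f ≡ tabulate (f ∘ inject₁) ++ List.[ f (fromℕ n) ]
    tabulate-∷ʳ {zero}  f = refl
    tabulate-∷ʳ {suc n} f = cong (f Fin.zero ∷_) (tabulate-∷ʳ (f ∘ Fin.suc))

    map-lookup-allFin : ∀ {n} (v : Vec A n) → map (lookup v) (allFin n) ≡ toList v
    map-lookup-allFin []      = refl
    map-lookup-allFin (a ∷ v) = cong (a ∷_) (begin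
      map (lookup (a ∷ v)) (tabulate Fin.suc) ≡⟨ map-tabulate Fin.suc (lookup (a ∷ v)) ⟩
      tabulate (lookup v)                       ≡⟨ sym (map-tabulate id (lookup v)) ⟩
      map (lookup v) (allFin _)                 ≡⟨ map-lookup-allFin v ⟩
      toList v                                  ∎)

  allFin-suc : ∀ n → allFin (suc n) ≡ Fin.zero ∷ map Fin.suc (allFin n)
  allFin-suc n = cong (Fin.zero ∷_) (sym (map-tabulate id Fin.suc))

  allFin-∷ʳ : ∀ n → allFin (suc n) ≡ map inject₁ (allFin n) ++ List.[ fromℕ n ]
  allFin-∷ʳ n = trans (tabulate-∷ʳ id) (cong (_++ List.[ fromℕ n ]) (sym (map-tabulate id inject₁)))

  all-allFin-suc : ∀ {n} (p : Fin (suc n) → Bool) →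
                   all p (allFin (suc n)) ≡ p Fin.zero ∧ all (p ∘ Fin.suc) (allFin n)
  all-allFin-suc {n} p = trans (cong (all p) (allFin-suc n)) (cong (p Fin.zero ∧_) (all-map p Fin.suc (allFin n)))

  all-allFin-∷ʳ : ∀ {n} (p : Fin (suc n) → Bool) →
                  all p (allFin (suc n)) ≡ all (p ∘ inject₁) (allFin n) ∧ p (fromℕ n)
  all-allFin-∷ʳ {n} p = begin
    all p (allFin (suc n))
      ≡⟨ cong (all p) (allFin-∷ʳ n) ⟩
    all p (map inject₁ (allFin n) ++ List.[ fromℕ n ])
      ≡⟨ all-++ p (map inject₁ (allFin n)) _ ⟩
    all p (map inject₁ (allFin n)) ∧ (p (fromℕ n) ∧ true)
      ≡⟨ cong₂ _∧_ (all-map p inject₁ (allFin n)) (∧-identityʳ _) ⟩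
    all (p ∘ inject₁) (allFin n) ∧ p (fromℕ n) ∎

  count-allFin-∷ʳ : ∀ {n} (p : Fin (suc n) → Bool) →
    count p (allFin (suc n)) ≡ count (p ∘ inject₁) (allFin n) + (if p (fromℕ n) then 1 else 0)
  count-allFin-∷ʳ {n} p = begin
    count p (allFin (suc n))
      ≡⟨ cong (count p) (allFin-∷ʳ n) ⟩
    count p (map inject₁ (allFin n) ++ List.[ fromℕ n ])
      ≡⟨ count-++ p (map inject₁ (allFin n)) _ ⟩
    count p (map inject₁ (allFin n)) + count p List.[ fromℕ n ]
      ≡⟨ cong (_+ count p List.[ fromℕ n ]) (count-map p inject₁ (allFin n)) ⟩
    count (p ∘ inject₁) (allFin n) + (if p (fromℕ n) then 1 else 0) ∎

  inject₁<ᵇfromℕ : ∀ {k} (j : Fin k) → (toℕ (inject₁ j) <ᵇ toℕ (fromℕ k)) ≡ true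
  inject₁<ᵇfromℕ Fin.zero    = refl
  inject₁<ᵇfromℕ (Fin.suc j) = inject₁<ᵇfromℕ j

  fromℕ≮ᵇinject₁ : ∀ {k} (j : Fin k) → (toℕ (fromℕ k) <ᵇ toℕ (inject₁ j)) ≡ false
  fromℕ≮ᵇinject₁ Fin.zero    = refl
  fromℕ≮ᵇinject₁ (Fin.suc j) = fromℕ≮ᵇinject₁ j

  n≮ᵇn : ∀ n → (n <ᵇ n) ≡ false
  n≮ᵇn zero    = refl
  n≮ᵇn (suc n) = n≮ᵇn n

  allEmpty hasLeft hasDown leftNoDown : ∀ {m} → Vec Cell m → Bool
  allEmpty v = all isEmpty (toList v)
  hasLeft  v = any isLeft (toList v)
  hasDown  v = any isDown (toList v)
  leftNoDown v = hasLeft v ∧ not (hasDown v)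

  column : ∀ {n k} → Filling n k → Fin k → Vec Cell n
  column T j = Vec.map (λ r → lookup r j) T

  columnEmpty : ∀ {n k} → Filling n k → Fin k → Bool
  columnEmpty T j = allEmpty (column T j)

  map-cellAt : ∀ {n k} {B : Set} (P : Cell → B) (T : Filling n k) j →
               map (λ i → P (cellAt T i j)) (allFin n) ≡ map P (toList (column T j))
  map-cellAt {n} P T j = begin
    map (λ i → P (cellAt T i j)) (allFin n)       ≡⟨ map-cong (λ i → cong P (sym (lookup-map i _ T))) (allFin n) ⟩
    map (P ∘ lookup (column T j)) (allFin n)      ≡⟨ map-∘ (allFin n) ⟩
    map P (map (lookup (column T j)) (allFin n))  ≡⟨ cong (map P) (map-lookup-allFin (column T j)) ⟩
    map P (toList (column T j))                   ∎

  wLeft-column : ∀ {n k} (T : Filling n k) → wLeft T ≡ count (leftNoDown ∘ column T) (allFin k)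
  wLeft-column {k = k} T = count-cong (λ j → cong₂ (λ l d → l ∧ not d)
    (cong or (map-cellAt isLeft T j)) (cong or (map-cellAt isDown T j))) (allFin k)

  -- Admissibility of the cell b, given whether the cells to its left (l) and below it (d) are empty.
  arrowOK : Cell → Bool → Bool → Bool
  arrowOK empty l d = true
  arrowOK left  l d = l
  arrowOK down  l d = d

  arrowOK-split : ∀ b l d → arrowOK b l d ≡ arrowOK b l true ∧ arrowOK b true d
  arrowOK-split empty l d = refl
  arrowOK-split left  l d = sym (∧-identityʳ l)
  arrowOK-split down  l d = refl

  leftClear : ∀ {k} → Vec Cell k → Fin k → Bool
  leftClear {k} r j = all (λ j′ → not (toℕ j′ <ᵇ toℕ j) ∨ isEmpty (lookup r j′)) (allFin k)

  rowOK : ∀ {k} → Vec Cell k → (Fin k → Bool) → Bool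
  rowOK {k} r clearBelow = all (λ j → arrowOK (lookup r j) (leftClear r j) (clearBelow j)) (allFin k)

  rowOK-cong : ∀ {k} (r : Vec Cell k) {e e′ : Fin k → Bool} → (∀ j → e j ≡ e′ j) → rowOK r e ≡ rowOK r e′
  rowOK-cong {k} r e≗e′ = all-cong (λ j → cong (arrowOK (lookup r j) (leftClear r j)) (e≗e′ j)) (allFin k)

  okCell-top : ∀ {n k} (r : Vec Cell k) (T : Filling n k) j b →
               okCell (r ∷ T) Fin.zero j b ≡ arrowOK b (leftClear r j) (columnEmpty T j)
  okCell-top r T j empty = refl
  okCell-top r T j left  = refl
  okCell-top {n} r T j down = trans
    (all-allFin-suc (λ i → not (toℕ {suc n} Fin.zero <ᵇ toℕ i) ∨ isEmpty (cellAt (r ∷ T) i j)))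
    (cong and (map-cellAt isEmpty T j))

  okCell-suc : ∀ {n k} (r : Vec Cell k) (T : Filling n k) i j b →
               okCell (r ∷ T) (Fin.suc i) j b ≡ okCell T i j b
  okCell-suc r T i j empty = refl
  okCell-suc r T i j left  = refl
  okCell-suc r T i j down  =
    all-allFin-suc (λ i′ → not (toℕ (Fin.suc i) <ᵇ toℕ i′) ∨ isEmpty (cellAt (r ∷ T) i′ j))

  isAltTableau-∷ : ∀ {n k} (r : Vec Cell k) (T : Filling n k) →
                   isAltTableau (r ∷ T) ≡ rowOK r (columnEmpty T) ∧ isAltTableau T
  isAltTableau-∷ {n} {k} r T = trans
    (all-allFin-suc (λ i → all (λ j → okCell (r ∷ T) i j (cellAt (r ∷ T) i j)) (allFin k)))
    (cong₂ _∧_ (all-cong (λ j → okCell-top r T j (lookup r j)) (allFin k))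
               (all-cong (λ i → all-cong (λ j → okCell-suc r T i j (cellAt T i j)) (allFin k)) (allFin n)))

  snocColumn : ∀ {n k} → Filling n k → Vec Cell n → Filling n (suc k)
  snocColumn = Vec.zipWith _∷ʳ_

  lookup-∷ʳ-inject₁ : ∀ {k} {A : Set} (r : Vec A k) b j → lookup (r ∷ʳ b) (inject₁ j) ≡ lookup r j
  lookup-∷ʳ-inject₁ (a ∷ r) b Fin.zero    = refl
  lookup-∷ʳ-inject₁ (a ∷ r) b (Fin.suc j) = lookup-∷ʳ-inject₁ r b j

  lookup-∷ʳ-fromℕ : ∀ {k} {A : Set} (r : Vec A k) b → lookup (r ∷ʳ b) (fromℕ k) ≡ b
  lookup-∷ʳ-fromℕ []      b = refl
  lookup-∷ʳ-fromℕ (a ∷ r) b = lookup-∷ʳ-fromℕ r b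

  column-snoc-inject₁ : ∀ {n k} (T : Filling n k) c j → column (snocColumn T c) (inject₁ j) ≡ column T j
  column-snoc-inject₁ []      []      j = refl
  column-snoc-inject₁ (r ∷ T) (b ∷ c) j = cong₂ _∷_ (lookup-∷ʳ-inject₁ r b j) (column-snoc-inject₁ T c j)

  column-snoc-fromℕ : ∀ {n k} (T : Filling n k) c → column (snocColumn T c) (fromℕ k) ≡ c
  column-snoc-fromℕ []      []      = refl
  column-snoc-fromℕ (r ∷ T) (b ∷ c) = cong₂ _∷_ (lookup-∷ʳ-fromℕ r b) (column-snoc-fromℕ T c)

  leftClear-∷ʳ-inject₁ : ∀ {k} (r : Vec Cell k) b j → leftClear (r ∷ʳ b) (inject₁ j) ≡ leftClear r j
  leftClear-∷ʳ-inject₁ {k} r b j = begin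
    leftClear (r ∷ʳ b) (inject₁ j)                     ≡⟨ all-allFin-∷ʳ clear ⟩
    all (clear ∘ inject₁) (allFin k) ∧ clear (fromℕ k) ≡⟨ cong₂ _∧_ (all-cong shift (allFin k)) last ⟩
    leftClear r j ∧ true                               ≡⟨ ∧-identityʳ _ ⟩
    leftClear r j                                      ∎
    where
    clear : Fin (suc k) → Bool
    clear j′ = not (toℕ j′ <ᵇ toℕ (inject₁ j)) ∨ isEmpty (lookup (r ∷ʳ b) j′)
    shift : ∀ j′ → clear (inject₁ j′) ≡ (not (toℕ j′ <ᵇ toℕ j) ∨ isEmpty (lookup r j′))
    shift j′ rewrite toℕ-inject₁ j′ | toℕ-inject₁ j | lookup-∷ʳ-inject₁ r b j′ = refl
    last : clear (fromℕ k) ≡ true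
    last rewrite fromℕ≮ᵇinject₁ j = refl

  leftClear-∷ʳ-fromℕ : ∀ {k} (r : Vec Cell k) b → leftClear (r ∷ʳ b) (fromℕ k) ≡ allEmpty r
  leftClear-∷ʳ-fromℕ {k} r b = begin
    leftClear (r ∷ʳ b) (fromℕ k)                       ≡⟨ all-allFin-∷ʳ clear ⟩
    all (clear ∘ inject₁) (allFin k) ∧ clear (fromℕ k) ≡⟨ cong₂ _∧_ (all-cong before (allFin k)) last ⟩
    all (isEmpty ∘ lookup r) (allFin k) ∧ true         ≡⟨ ∧-identityʳ _ ⟩
    and (map (isEmpty ∘ lookup r) (allFin k))          ≡⟨ cong and (map-∘ (allFin k)) ⟩
    and (map isEmpty (map (lookup r) (allFin k)))      ≡⟨ cong (and ∘ map isEmpty) (map-lookup-allFin r) ⟩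
    allEmpty r                                         ∎
    where
    clear : Fin (suc k) → Bool
    clear j′ = not (toℕ j′ <ᵇ toℕ (fromℕ k)) ∨ isEmpty (lookup (r ∷ʳ b) j′)
    before : ∀ j′ → clear (inject₁ j′) ≡ isEmpty (lookup r j′)
    before j′ rewrite inject₁<ᵇfromℕ j′ | lookup-∷ʳ-inject₁ r b j′ = refl
    last : clear (fromℕ k) ≡ true
    last rewrite n≮ᵇn (toℕ (fromℕ k)) = refl

  rowOK-∷ʳ : ∀ {k} (r : Vec Cell k) b (clearBelow : Fin (suc k) → Bool) →
    rowOK (r ∷ʳ b) clearBelow ≡ rowOK r (clearBelow ∘ inject₁) ∧ arrowOK b (allEmpty r) (clearBelow (fromℕ k))
  rowOK-∷ʳ {k} r b clearBelow =
    trans (all-allFin-∷ʳ ok) (cong₂ _∧_ (all-cong shift (allFin k)) last)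
    where
    ok : Fin (suc k) → Bool
    ok j = arrowOK (lookup (r ∷ʳ b) j) (leftClear (r ∷ʳ b) j) (clearBelow j)
    shift : ∀ j → ok (inject₁ j) ≡ arrowOK (lookup r j) (leftClear r j) (clearBelow (inject₁ j))
    shift j rewrite lookup-∷ʳ-inject₁ r b j | leftClear-∷ʳ-inject₁ r b j = refl
    last : ok (fromℕ k) ≡ arrowOK b (allEmpty r) (clearBelow (fromℕ k))
    last rewrite lookup-∷ʳ-fromℕ r b | leftClear-∷ʳ-fromℕ r b = refl

  validColumn : ∀ {n} → Vec Cell n → Bool
  validColumn []      = true
  validColumn (b ∷ c) = arrowOK b true (allEmpty c) ∧ validColumn c

  emptyAtLefts : ∀ {n k} → Filling n k → Vec Cell n → Bool
  emptyAtLefts []      []      = true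
  emptyAtLefts (r ∷ T) (b ∷ c) = arrowOK b (allEmpty r) true ∧ emptyAtLefts T c

  isAltTableau-snoc : ∀ {n k} (T : Filling n k) c →
    isAltTableau (snocColumn T c) ≡ isAltTableau T ∧ (validColumn c ∧ emptyAtLefts T c)
  isAltTableau-snoc []      []      = refl
  isAltTableau-snoc {suc n} {k} (r ∷ T) (b ∷ c) = begin
    isAltTableau ((r ∷ʳ b) ∷ snocColumn T c)
      ≡⟨ isAltTableau-∷ (r ∷ʳ b) (snocColumn T c) ⟩
    rowOK (r ∷ʳ b) (columnEmpty (snocColumn T c)) ∧ isAltTableau (snocColumn T c)
      ≡⟨ cong₂ _∧_ (rowOK-∷ʳ r b (columnEmpty (snocColumn T c))) (isAltTableau-snoc T c) ⟩
    (rowOK r (columnEmpty (snocColumn T c) ∘ inject₁) ∧ arrowOK b (allEmpty r) (columnEmpty (snocColumn T c) (fromℕ k)))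
      ∧ (isAltTableau T ∧ (validColumn c ∧ emptyAtLefts T c))
      ≡⟨ cong (λ z → z ∧ (isAltTableau T ∧ (validColumn c ∧ emptyAtLefts T c))) (cong₂ _∧_
           (rowOK-cong r (λ j → cong allEmpty (column-snoc-inject₁ T c j)))
           (trans (cong (λ v → arrowOK b (allEmpty r) (allEmpty v)) (column-snoc-fromℕ T c))
                  (arrowOK-split b (allEmpty r) (allEmpty c)))) ⟩
    (rowOK r (columnEmpty T) ∧ (arrowOK b (allEmpty r) true ∧ arrowOK b true (allEmpty c)))
      ∧ (isAltTableau T ∧ (validColumn c ∧ emptyAtLefts T c))
      ≡⟨ solve 6 (λ ρ a d τ v e → (ρ ⊕ (a ⊕ d)) ⊕ (τ ⊕ (v ⊕ e)) ⊜ (ρ ⊕ τ) ⊕ ((d ⊕ v) ⊕ (a ⊕ e)))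
                 refl
           (rowOK r (columnEmpty T)) (arrowOK b (allEmpty r) true) (arrowOK b true (allEmpty c))
           (isAltTableau T) (validColumn c) (emptyAtLefts T c) ⟩
    (rowOK r (columnEmpty T) ∧ isAltTableau T) ∧ (validColumn (b ∷ c) ∧ emptyAtLefts (r ∷ T) (b ∷ c))
      ≡⟨ cong (_∧ (validColumn (b ∷ c) ∧ emptyAtLefts (r ∷ T) (b ∷ c))) (sym (isAltTableau-∷ r T)) ⟩
    isAltTableau (r ∷ T) ∧ (validColumn (b ∷ c) ∧ emptyAtLefts (r ∷ T) (b ∷ c)) ∎

  wLeft-snoc : ∀ {n k} (T : Filling n k) c →
               wLeft (snocColumn T c) ≡ wLeft T + (if leftNoDown c then 1 else 0)
  wLeft-snoc {k = k} T c = begin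
    wLeft (snocColumn T c)
      ≡⟨ wLeft-column (snocColumn T c) ⟩
    count (leftNoDown ∘ column (snocColumn T c)) (allFin (suc k))
      ≡⟨ count-allFin-∷ʳ (leftNoDown ∘ column (snocColumn T c)) ⟩
    count (leftNoDown ∘ column (snocColumn T c) ∘ inject₁) (allFin k)
      + (if leftNoDown (column (snocColumn T c) (fromℕ k)) then 1 else 0)
      ≡⟨ cong₂ _+_ (count-cong (cong leftNoDown ∘ column-snoc-inject₁ T c) (allFin k))
                   (cong (λ v → if leftNoDown v then 1 else 0) (column-snoc-fromℕ T c)) ⟩
    count (leftNoDown ∘ column T) (allFin k) + (if leftNoDown c then 1 else 0)
      ≡⟨ cong (_+ _) (sym (wLeft-column T)) ⟩
    wLeft T + (if leftNoDown c then 1 else 0) ∎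

  nonLefts : ∀ {n} → Vec Cell n → ℕ
  nonLefts []          = 0
  nonLefts (empty ∷ c) = suc (nonLefts c)
  nonLefts (left  ∷ c) = nonLefts c
  nonLefts (down  ∷ c) = suc (nonLefts c)

  emptyRow : ∀ k → Vec Cell k
  emptyRow k = replicate k empty

  insertEmptyRows : ∀ {n k} (c : Vec Cell n) → Filling (nonLefts c) k → Filling n k
  insertEmptyRows []                []      = []
  insertEmptyRows (empty ∷ c)       (r ∷ T) = r ∷ insertEmptyRows c T
  insertEmptyRows {k = k} (left ∷ c) T      = emptyRow k ∷ insertEmptyRows c T
  insertEmptyRows (down  ∷ c)       (r ∷ T) = r ∷ insertEmptyRows c T

  validColumn-emptyRow : ∀ n → validColumn (emptyRow n) ≡ true
  validColumn-emptyRow zero    = refl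
  validColumn-emptyRow (suc n) = validColumn-emptyRow n

  nonLefts-emptyRow : ∀ n → nonLefts (emptyRow n) ≡ n
  nonLefts-emptyRow zero    = refl
  nonLefts-emptyRow (suc n) = cong suc (nonLefts-emptyRow n)

  foldr-column-insertEmptyRows :
    ∀ (P : Cell → Bool) (_⊙_ : Bool → Bool → Bool) e → (∀ z → P empty ⊙ z ≡ z) →
    ∀ {n k} (c : Vec Cell n) (T : Filling (nonLefts c) k) j →
    List.foldr _⊙_ e (map P (toList (column (insertEmptyRows c T) j)))
      ≡ List.foldr _⊙_ e (map P (toList (column T j)))
  foldr-column-insertEmptyRows P _⊙_ e neutral [] [] j = refl
  foldr-column-insertEmptyRows P _⊙_ e neutral (empty ∷ c) (r ∷ T) j =
    cong (P (lookup r j) ⊙_) (foldr-column-insertEmptyRows P _⊙_ e neutral c T j)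
  foldr-column-insertEmptyRows P _⊙_ e neutral (left ∷ c) T j
    rewrite lookup-replicate j empty =
    trans (neutral _) (foldr-column-insertEmptyRows P _⊙_ e neutral c T j)
  foldr-column-insertEmptyRows P _⊙_ e neutral (down ∷ c) (r ∷ T) j =
    cong (P (lookup r j) ⊙_) (foldr-column-insertEmptyRows P _⊙_ e neutral c T j)

  wLeft-insertEmptyRows : ∀ {n k} (c : Vec Cell n) (T : Filling (nonLefts c) k) →
                          wLeft (insertEmptyRows c T) ≡ wLeft T
  wLeft-insertEmptyRows {k = k} c T = begin
    wLeft (insertEmptyRows c T)                            ≡⟨ wLeft-column (insertEmptyRows c T) ⟩
    count (leftNoDown ∘ column (insertEmptyRows c T)) (allFin k) ≡⟨ count-cong same (allFin k) ⟩
    count (leftNoDown ∘ column T) (allFin k)               ≡⟨ sym (wLeft-column T) ⟩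
    wLeft T                                                ∎
    where
    same : ∀ j → leftNoDown (column (insertEmptyRows c T) j) ≡ leftNoDown (column T j)
    same j = cong₂ (λ l d → l ∧ not d)
      (foldr-column-insertEmptyRows isLeft _∨_ false (λ _ → refl) c T j)
      (foldr-column-insertEmptyRows isDown _∨_ false (λ _ → refl) c T j)

  rowOK-emptyRow : ∀ k (clearBelow : Fin k → Bool) → rowOK (emptyRow k) clearBelow ≡ true
  rowOK-emptyRow k clearBelow = trans
    (all-cong (λ j → cong (λ b → arrowOK b (leftClear (emptyRow k) j) (clearBelow j)) (lookup-replicate j empty))
              (allFin k))
    (all-const-true (allFin k))

  isAltTableau-∷-cong : ∀ {m n k} (r : Vec Cell k) {T : Filling m k} {U : Filling n k} →
    (∀ j → columnEmpty T j ≡ columnEmpty U j) → isAltTableau T ≡ isAltTableau U →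
    isAltTableau (r ∷ T) ≡ isAltTableau (r ∷ U)
  isAltTableau-∷-cong r {T} {U} T≗U T≡U = begin
    isAltTableau (r ∷ T)                      ≡⟨ isAltTableau-∷ r T ⟩
    rowOK r (columnEmpty T) ∧ isAltTableau T  ≡⟨ cong₂ _∧_ (rowOK-cong r T≗U) T≡U ⟩
    rowOK r (columnEmpty U) ∧ isAltTableau U  ≡⟨ sym (isAltTableau-∷ r U) ⟩
    isAltTableau (r ∷ U)                      ∎

  isAltTableau-insertEmptyRows : ∀ {n k} (c : Vec Cell n) (T : Filling (nonLefts c) k) →
                                 isAltTableau (insertEmptyRows c T) ≡ isAltTableau T
  isAltTableau-insertEmptyRows [] [] = refl
  isAltTableau-insertEmptyRows (empty ∷ c) (r ∷ T) = isAltTableau-∷-cong r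
    (foldr-column-insertEmptyRows isEmpty _∧_ true (λ _ → refl) c T) (isAltTableau-insertEmptyRows c T)
  isAltTableau-insertEmptyRows {k = k} (left ∷ c) T = begin
    isAltTableau (emptyRow k ∷ insertEmptyRows c T)
      ≡⟨ isAltTableau-∷ (emptyRow k) (insertEmptyRows c T) ⟩
    rowOK (emptyRow k) (columnEmpty (insertEmptyRows c T)) ∧ isAltTableau (insertEmptyRows c T)
      ≡⟨ cong₂ _∧_ (rowOK-emptyRow k _) (isAltTableau-insertEmptyRows c T) ⟩
    isAltTableau T ∎
  isAltTableau-insertEmptyRows (down ∷ c) (r ∷ T) = isAltTableau-∷-cong r
    (foldr-column-insertEmptyRows isEmpty _∧_ true (λ _ → refl) c T) (isAltTableau-insertEmptyRows c T)

-- Among the valid columns c of height n, V p n sums p (nonLefts c) over those with a ← but no ↓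
-- and W f n sums f (nonLefts c) over those with a ↓; the recursions split off the top cell.
module ColumnSums {a} {A : Set a} (_⊕_ : A → A → A) (ε : A) where

  V W : (ℕ → A) → ℕ → A
  V p ℕ.zero    = ε
  V p (ℕ.suc n) = (V (λ e → p (ℕ.suc e)) n ⊕ V p n) ⊕ p n
  W f ℕ.zero    = ε
  W f (ℕ.suc n) = (f (ℕ.suc n) ⊕ W (λ e → f (ℕ.suc e)) n) ⊕ W f n

module StirlingSums where

  open import Data.Nat using (zero; suc; _+_; _*_; _<_; _⊓_; z≤n; s≤s)
  open import Data.Nat.Properties
    using (*-zeroʳ; ≤-trans; n≤1+n; +-cancelʳ-≡; ≤-total; m≤n⇒m⊓n≡m; m≥n⇒m⊓n≡n)
  open import Data.Sum using (inj₁; inj₂)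
  open import Data.Nat.Solver using (module +-*-Solver)
  open import Relation.Binary.PropositionalEquality
  open +-*-Solver
  open ColumnSums _+_ 0 public

  S-vanish : ∀ {m j} → m < j → S m j ≡ 0
  S-vanish {zero}  {suc j} _       = refl
  S-vanish {suc m} {suc j} (s≤s p)
    rewrite S-vanish (≤-trans p (n≤1+n j)) | S-vanish p | *-zeroʳ j = refl

  S-product-vanish : ∀ n k {j} → n ⊓ k < j → S (suc n) (suc j) * S (suc k) (suc j) ≡ 0
  S-product-vanish n k {j} n⊓k<j with ≤-total n k
  ... | inj₁ n≤k rewrite S-vanish {suc n} {suc j} (s≤s (subst (_< j) (m≤n⇒m⊓n≡m n≤k) n⊓k<j)) = refl
  ... | inj₂ k≤n rewrite S-vanish {suc k} {suc j} (s≤s (subst (_< j) (m≥n⇒m⊓n≡n k≤n) n⊓k<j)) =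
    *-zeroʳ (S (suc n) (suc j))

  S-suc-1 : ∀ m → S (suc m) 1 ≡ 1
  S-suc-1 zero    = refl
  S-suc-1 (suc m) rewrite S-suc-1 m = refl

  V-linear : ∀ n a (g h : ℕ → ℕ) → V (λ m → a * g m + h m) n ≡ a * V g n + V h n
  V-linear zero    a g h = sym (cong (_+ 0) (*-zeroʳ a))
  V-linear (suc n) a g h
    rewrite V-linear n a (λ e → g (suc e)) (λ e → h (suc e)) | V-linear n a g h =
    solve 7 (λ a p q r s t u → ((a :* p :+ q) :+ (a :* r :+ s)) :+ (a :* t :+ u)
                              := a :* (p :+ r :+ t) :+ (q :+ s :+ u)) refl
            a (V (λ e → g (suc e)) n) (V (λ e → h (suc e)) n) (V g n) (V h n) (g n) (h n)

  W-linear : ∀ n a (g h : ℕ → ℕ) → W (λ m → a * g m + h m) n ≡ a * W g n + W h n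
  W-linear zero    a g h = sym (cong (_+ 0) (*-zeroʳ a))
  W-linear (suc n) a g h
    rewrite W-linear n a (λ e → g (suc e)) (λ e → h (suc e)) | W-linear n a g h =
    solve 7 (λ a p q r s t u → ((a :* t :+ u) :+ (a :* p :+ q)) :+ (a :* r :+ s)
                              := a :* (t :+ p :+ r) :+ (u :+ q :+ s)) refl
            a (W (λ e → g (suc e)) n) (W (λ e → h (suc e)) n) (W g n) (W h n) (g (suc n)) (h (suc n))

  V-zero : ∀ n → V (λ _ → 0) n ≡ 0
  V-zero zero    = refl
  V-zero (suc n) rewrite V-zero n = refl

  W-zero : ∀ n → W (λ _ → 0) n ≡ 0
  W-zero zero    = refl
  W-zero (suc n) rewrite W-zero n = refl

  -- Both identities use S (m + 2) (j + 1) = (j + 1) S (m + 1) (j + 1) + S (m + 1) j,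
  -- which makes the shifted sequence a linear combination of two unshifted ones.
  V-stirling : ∀ n j → V (λ m → S (suc m) j) n ≡ j * S (suc n) (suc j)
  V-stirling zero    zero    = refl
  V-stirling zero    (suc j) rewrite S-vanish {1} {suc (suc j)} (s≤s (s≤s z≤n)) = sym (*-zeroʳ (suc j))
  V-stirling (suc n) zero    = V-zero (suc n)
  V-stirling (suc n) (suc j) = begin
    V (λ e → suc j * S (suc e) (suc j) + S (suc e) j) n + V (λ m → S (suc m) (suc j)) n + B
      ≡⟨ cong (λ z → z + V (λ m → S (suc m) (suc j)) n + B)
              (V-linear n (suc j) (λ m → S (suc m) (suc j)) (λ m → S (suc m) j)) ⟩
    (suc j * V (λ m → S (suc m) (suc j)) n + V (λ m → S (suc m) j) n) + V (λ m → S (suc m) (suc j)) n + B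
      ≡⟨ cong₂ (λ a b → (suc j * a + b) + a + B) (V-stirling n (suc j)) (V-stirling n j) ⟩
    (suc j * (suc j * A) + j * B) + suc j * A + B
      ≡⟨ solve 3 (λ j A B → ((con 1 :+ j) :* ((con 1 :+ j) :* A) :+ j :* B) :+ (con 1 :+ j) :* A :+ B
                          := (con 1 :+ j) :* ((con 2 :+ j) :* A :+ B)) refl j A B ⟩
    suc j * (suc (suc j) * A + B) ∎
    where
    open ≡-Reasoning
    A = S (suc n) (suc (suc j))
    B = S (suc n) (suc j)

  W-stirling : ∀ n j → W (λ m → S (suc m) j) n + S (suc n) j ≡ j * S (suc n) j + j * j * S (suc n) (suc j)
  W-stirling zero    zero          = refl
  W-stirling zero    (suc zero)    = refl
  W-stirling zero    (suc (suc j)) rewrite S-vanish {1} {suc (suc j)} (s≤s (s≤s z≤n)) =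
    solve 1 (λ j → con 0 := (con 2 :+ j) :* con 0 :+ (con 2 :+ j) :* (con 2 :+ j) :* con 0) refl j
  W-stirling (suc n) zero    rewrite W-zero n = refl
  W-stirling (suc n) (suc j) = +-cancelʳ-≡ (suc (suc j) * B + C) _ _ (begin
    (S (suc (suc n)) (suc j) + W (λ e → suc j * S (suc e) (suc j) + S (suc e) j) n + W₁)
      + (suc j * B + C) + (suc (suc j) * B + C)
      ≡⟨ cong (λ z → (S (suc (suc n)) (suc j) + z + W₁) + (suc j * B + C) + (suc (suc j) * B + C))
              (W-linear n (suc j) (λ m → S (suc m) (suc j)) (λ m → S (suc m) j)) ⟩
    ((suc j * B + C) + (suc j * W₁ + W₀) + W₁) + (suc j * B + C) + (suc (suc j) * B + C)
      ≡⟨ solve 5 (λ j B C W₁ W₀ →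
                   ((((con 1 :+ j) :* B :+ C) :+ ((con 1 :+ j) :* W₁ :+ W₀) :+ W₁) :+ ((con 1 :+ j) :* B :+ C))
                     :+ ((con 2 :+ j) :* B :+ C)
                   := (con 2 :+ j) :* (W₁ :+ B) :+ (W₀ :+ C) :+ (con 2 :+ con 2 :* j) :* B :+ con 2 :* C)
                 refl j B C W₁ W₀ ⟩
    suc (suc j) * (W₁ + B) + (W₀ + C) + (2 + 2 * j) * B + 2 * C
      ≡⟨ cong₂ (λ a b → suc (suc j) * a + b + (2 + 2 * j) * B + 2 * C) (W-stirling n (suc j)) (W-stirling n j) ⟩
    suc (suc j) * (suc j * B + suc j * suc j * A) + (j * C + j * j * B) + (2 + 2 * j) * B + 2 * C
      ≡⟨ solve 4 (λ j A B C →
                   (con 2 :+ j) :* ((con 1 :+ j) :* B :+ (con 1 :+ j) :* (con 1 :+ j) :* A) :+ (j :* C :+ j :* j :* B)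
                     :+ (con 2 :+ con 2 :* j) :* B :+ con 2 :* C
                   := (con 1 :+ j) :* ((con 1 :+ j) :* B :+ C) :+ (con 1 :+ j) :* (con 1 :+ j) :* ((con 2 :+ j) :* A :+ B)
                     :+ ((con 2 :+ j) :* B :+ C))
                 refl j A B C ⟩
    suc j * (suc j * B + C) + suc j * suc j * (suc (suc j) * A + B) + (suc (suc j) * B + C) ∎)
    where
    open ≡-Reasoning
    A = S (suc n) (suc (suc j))
    B = S (suc n) (suc j)
    C = S (suc n) j
    W₁ = W (λ m → S (suc m) (suc j)) n
    W₀ = W (λ m → S (suc m) j) n

module SemiringSums {c ℓ} (R : CommutativeSemiring c ℓ) where

  open import Function using (_∘_)
  open import Data.Bool using (Bool; true; false; _∧_; if_then_else_)
  import Data.Bool as Bool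
  open import Data.Nat as ℕ using (zero; suc)
  import Data.Nat.Properties as ℕ
  open import Data.List using (List; []; _∷_; [_]; map; concatMap; _++_; filter; upTo)
  open import Data.List.Properties using (map-upTo; upTo-∷ʳ)
  open import Data.Sum using (inj₁; inj₂)
  open import Data.Vec using (Vec; []; _∷_; _∷ʳ_)
  import Relation.Binary.PropositionalEquality as ≡
  open ≡ using (_≡_)
  open Tableau
  open CommutativeSemiring R hiding (zero)
  open Poly R
  open ColumnSums _+_ 0#
  open import Algebra.Properties.Semiring.Mult semiring using (_×_; ×-homo-+; ×1-homo-*)
  open import Algebra.Solver.Ring.NaturalCoefficients.Default R using (solve; _:=_; _:+_; _:*_)
  open import Relation.Binary.Reasoning.Setoid setoid

  private variable A B : Set

  infixr 8 [_]·_

  [_]·_ : Bool → Carrier → Carrier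
  [ true  ]· t = t
  [ false ]· t = 0#

  []·-cong : ∀ b {s t} → s ≈ t → [ b ]· s ≈ [ b ]· t
  []·-cong true  s≈t = s≈t
  []·-cong false s≈t = refl

  []·-0# : ∀ b → [ b ]· 0# ≈ 0#
  []·-0# true  = refl
  []·-0# false = refl

  []·-+ : ∀ b s t → [ b ]· (s + t) ≈ [ b ]· s + [ b ]· t
  []·-+ true  s t = refl
  []·-+ false s t = sym (+-identityˡ 0#)

  []·-*ˡ : ∀ b k t → [ b ]· (k * t) ≈ k * [ b ]· t
  []·-*ˡ true  k t = refl
  []·-*ˡ false k t = sym (zeroʳ k)

  []·-∧ : ∀ a b t → [ a ∧ b ]· t ≡ [ a ]· [ b ]· t
  []·-∧ true  b t = ≡.refl
  []·-∧ false b t = ≡.refl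

  ∑ : List A → (A → Carrier) → Carrier
  ∑ []       f = 0#
  ∑ (a ∷ as) f = f a + ∑ as f

  ∑-cong : ∀ (xs : List A) {f g : A → Carrier} → (∀ a → f a ≈ g a) → ∑ xs f ≈ ∑ xs g
  ∑-cong []       f≈g = refl
  ∑-cong (a ∷ xs) f≈g = +-cong (f≈g a) (∑-cong xs f≈g)

  ∑-++ : ∀ (xs ys : List A) f → ∑ (xs ++ ys) f ≈ ∑ xs f + ∑ ys f
  ∑-++ []       ys f = sym (+-identityˡ _)
  ∑-++ (a ∷ xs) ys f = trans (+-congˡ (∑-++ xs ys f)) (sym (+-assoc _ _ _))

  ∑-map : ∀ (h : A → B) xs (f : B → Carrier) → ∑ (map h xs) f ≈ ∑ xs (f ∘ h)
  ∑-map h []       f = refl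
  ∑-map h (a ∷ xs) f = +-congˡ (∑-map h xs f)

  ∑-concatMap : ∀ (g : A → List B) xs (f : B → Carrier) →
                ∑ (concatMap g xs) f ≈ ∑ xs (λ a → ∑ (g a) f)
  ∑-concatMap g []       f = refl
  ∑-concatMap g (a ∷ xs) f = trans (∑-++ (g a) (concatMap g xs) f) (+-congˡ (∑-concatMap g xs f))

  ∑-0# : ∀ (xs : List A) → ∑ xs (λ _ → 0#) ≈ 0#
  ∑-0# []       = refl
  ∑-0# (a ∷ xs) = trans (+-identityˡ _) (∑-0# xs)

  ∑-+ : ∀ xs (f g : A → Carrier) → ∑ xs (λ a → f a + g a) ≈ ∑ xs f + ∑ xs g
  ∑-+ []       f g = sym (+-identityˡ 0#)
  ∑-+ (a ∷ xs) f g = trans (+-congˡ (∑-+ xs f g)) (interchange (f a) (g a) (∑ xs f) (∑ xs g))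
    where open import Algebra.Properties.CommutativeSemigroup +-commutativeSemigroup using (interchange)

  ∑-*ˡ : ∀ xs k (f : A → Carrier) → ∑ xs (λ a → k * f a) ≈ k * ∑ xs f
  ∑-*ˡ []       k f = sym (zeroʳ k)
  ∑-*ˡ (a ∷ xs) k f = trans (+-congˡ (∑-*ˡ xs k f)) (sym (distribˡ k (f a) (∑ xs f)))

  ∑-[]· : ∀ xs b (f : A → Carrier) → ∑ xs (λ a → [ b ]· f a) ≈ [ b ]· ∑ xs f
  ∑-[]· xs true  f = refl
  ∑-[]· xs false f = ∑-0# xs

  ∑-swap : ∀ xs (ys : List B) (f : A → B → Carrier) →
           ∑ xs (λ a → ∑ ys (f a)) ≈ ∑ ys (λ b → ∑ xs (λ a → f a b))
  ∑-swap []       ys f = sym (∑-0# ys)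
  ∑-swap (a ∷ xs) ys f =
    trans (+-congˡ (∑-swap xs ys f)) (sym (∑-+ ys (f a) (λ b → ∑ xs (λ a′ → f a′ b))))

  sumR-map : ∀ xs (g : A → Carrier) → sumR (map g xs) ≡ ∑ xs g
  sumR-map []       g = ≡.refl
  sumR-map (a ∷ xs) g = ≡.cong (g a +_) (sumR-map xs g)

  ∑-filter : ∀ (p : A → Bool) xs (g : A → Carrier) →
             ∑ (filter (λ a → p a Bool.≟ true) xs) g ≈ ∑ xs (λ a → [ p a ]· g a)
  ∑-filter p []       g = refl
  ∑-filter p (a ∷ xs) g with p a
  ... | true  = +-congˡ (∑-filter p xs g)
  ... | false = trans (∑-filter p xs g) (sym (+-identityˡ _))

  ∑-allVecs-suc : ∀ (xs : List A) m (f : Vec A (suc m) → Carrier) →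
                  ∑ (allVecs xs (suc m)) f ≈ ∑ xs (λ a → ∑ (allVecs xs m) (λ v → f (a ∷ v)))
  ∑-allVecs-suc xs m f = trans (∑-concatMap (λ a → map (a ∷_) (allVecs xs m)) xs f)
                               (∑-cong xs (λ a → ∑-map (a ∷_) (allVecs xs m) f))

  ∑-allVecs-∷ʳ : ∀ (xs : List A) m (f : Vec A (suc m) → Carrier) →
                 ∑ (allVecs xs (suc m)) f ≈ ∑ (allVecs xs m) (λ v → ∑ xs (λ a → f (v ∷ʳ a)))
  ∑-allVecs-∷ʳ xs zero    f =
    trans (∑-allVecs-suc xs zero f) (trans (∑-cong xs (λ a → +-identityʳ _)) (sym (+-identityʳ _)))
  ∑-allVecs-∷ʳ xs (suc m) f = begin
    ∑ (allVecs xs (suc (suc m))) f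
      ≈⟨ ∑-allVecs-suc xs (suc m) f ⟩
    ∑ xs (λ a → ∑ (allVecs xs (suc m)) (λ v → f (a ∷ v)))
      ≈⟨ ∑-cong xs (λ a → ∑-allVecs-∷ʳ xs m (λ v → f (a ∷ v))) ⟩
    ∑ xs (λ a → ∑ (allVecs xs m) (λ v → ∑ xs (λ b → f (a ∷ (v ∷ʳ b)))))
      ≈⟨ ∑-allVecs-suc xs m (λ w → ∑ xs (λ b → f (w ∷ʳ b))) ⟨
    ∑ (allVecs xs (suc m)) (λ v → ∑ xs (λ a → f (v ∷ʳ a))) ∎

  ∑-allFillings-snoc : ∀ n k (F : Filling n (suc k) → Carrier) →
    ∑ (allFillings n (suc k)) F ≈ ∑ (allFillings n k) (λ T → ∑ (allVecs allCells n) (F ∘ snocColumn T))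
  ∑-allFillings-snoc zero    k F = +-congʳ (sym (+-identityʳ _))
  ∑-allFillings-snoc (suc n) k F = begin
    ∑ (allFillings (suc n) (suc k)) F
      ≈⟨ ∑-allVecs-suc (allVecs allCells (suc k)) n F ⟩
    ∑ (allVecs allCells (suc k)) (λ r → ∑ (allFillings n (suc k)) (λ T → F (r ∷ T)))
      ≈⟨ ∑-cong (allVecs allCells (suc k)) (λ r → ∑-allFillings-snoc n k (λ T → F (r ∷ T))) ⟩
    ∑ (allVecs allCells (suc k)) (λ r → ∑ (allFillings n k) (λ T → ∑ cols (λ c → F (r ∷ snocColumn T c))))
      ≈⟨ ∑-allVecs-∷ʳ allCells k _ ⟩
    ∑ (allVecs allCells k) (λ r → ∑ allCells (λ b → ∑ (allFillings n k) (λ T →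
      ∑ cols (λ c → F ((r ∷ʳ b) ∷ snocColumn T c)))))
      ≈⟨ ∑-cong (allVecs allCells k) (λ r → ∑-swap allCells (allFillings n k)
           (λ b T → ∑ cols (λ c → F ((r ∷ʳ b) ∷ snocColumn T c)))) ⟩
    ∑ (allVecs allCells k) (λ r → ∑ (allFillings n k) (λ T → ∑ allCells (λ b →
      ∑ cols (λ c → F ((r ∷ʳ b) ∷ snocColumn T c)))))
      ≈⟨ ∑-cong (allVecs allCells k) (λ r → ∑-cong (allFillings n k) (λ T →
           ∑-allVecs-suc allCells n (F ∘ snocColumn (r ∷ T)))) ⟨
    ∑ (allVecs allCells k) (λ r → ∑ (allFillings n k) (λ T →
      ∑ (allVecs allCells (suc n)) (F ∘ snocColumn (r ∷ T))))
      ≈⟨ ∑-allVecs-suc (allVecs allCells k) n (λ T → ∑ (allVecs allCells (suc n)) (F ∘ snocColumn T)) ⟨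
    ∑ (allFillings (suc n) k) (λ T → ∑ (allVecs allCells (suc n)) (F ∘ snocColumn T)) ∎
    where
    cols = allVecs allCells n

  ∑-allEmpty : ∀ k (h : Vec Cell k → Carrier) →
               ∑ (allVecs allCells k) (λ r → [ allEmpty r ]· h r) ≈ h (emptyRow k)
  ∑-allEmpty zero    h = +-identityʳ _
  ∑-allEmpty (suc k) h = begin
    ∑ (allVecs allCells (suc k)) (λ r → [ allEmpty r ]· h r)
      ≈⟨ ∑-allVecs-suc allCells k (λ r → [ allEmpty r ]· h r) ⟩
    ∑ rows (λ r → [ allEmpty r ]· h (empty ∷ r)) + (∑ rows (λ _ → 0#) + (∑ rows (λ _ → 0#) + 0#))
      ≈⟨ +-cong (∑-allEmpty k (h ∘ (empty ∷_)))
                (trans (+-cong (∑-0# rows) (trans (+-identityʳ _) (∑-0# rows))) (+-identityˡ _)) ⟩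
    h (emptyRow (suc k)) + 0#
      ≈⟨ +-identityʳ _ ⟩
    h (emptyRow (suc k)) ∎
    where
    rows = allVecs allCells k

  ∑-emptyAtLefts : ∀ {n} k (c : Vec Cell n) (F : Filling n k → Carrier) →
    ∑ (allFillings n k) (λ T → [ emptyAtLefts T c ]· F T) ≈ ∑ (allFillings (nonLefts c) k) (F ∘ insertEmptyRows c)
  ∑-emptyAtLefts k []          F = refl
  ∑-emptyAtLefts {suc n} k (empty ∷ c) F =
    trans (∑-allVecs-suc (allVecs allCells k) n _)
     (trans (∑-cong (allVecs allCells k) (λ r → ∑-emptyAtLefts k c (λ T → F (r ∷ T))))
            (sym (∑-allVecs-suc (allVecs allCells k) (nonLefts c) (F ∘ insertEmptyRows (empty ∷ c)))))
  ∑-emptyAtLefts {suc n} k (left ∷ c) F = begin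
    ∑ (allFillings (suc n) k) (λ T → [ emptyAtLefts T (left ∷ c) ]· F T)
      ≈⟨ ∑-allVecs-suc (allVecs allCells k) n _ ⟩
    ∑ (allVecs allCells k) (λ r → ∑ (allFillings n k) (λ T → [ allEmpty r ∧ emptyAtLefts T c ]· F (r ∷ T)))
      ≈⟨ ∑-cong (allVecs allCells k) (λ r → trans
           (∑-cong (allFillings n k) (λ T → reflexive ([]·-∧ (allEmpty r) (emptyAtLefts T c) (F (r ∷ T)))))
           (∑-[]· (allFillings n k) (allEmpty r) _)) ⟩
    ∑ (allVecs allCells k) (λ r → [ allEmpty r ]· ∑ (allFillings n k) (λ T → [ emptyAtLefts T c ]· F (r ∷ T)))
      ≈⟨ ∑-allEmpty k (λ r → ∑ (allFillings n k) (λ T → [ emptyAtLefts T c ]· F (r ∷ T))) ⟩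
    ∑ (allFillings n k) (λ T → [ emptyAtLefts T c ]· F (emptyRow k ∷ T))
      ≈⟨ ∑-emptyAtLefts k c (λ T → F (emptyRow k ∷ T)) ⟩
    ∑ (allFillings (nonLefts c) k) (F ∘ insertEmptyRows (left ∷ c)) ∎
  ∑-emptyAtLefts {suc n} k (down ∷ c) F =
    trans (∑-allVecs-suc (allVecs allCells k) n _)
     (trans (∑-cong (allVecs allCells k) (λ r → ∑-emptyAtLefts k c (λ T → F (r ∷ T))))
            (sym (∑-allVecs-suc (allVecs allCells k) (nonLefts c) (F ∘ insertEmptyRows (down ∷ c)))))

  columnSum : (Bool → Bool → ℕ → Carrier) → ℕ → Carrier
  columnSum H n = ∑ (allVecs allCells n) (λ c → [ validColumn c ]· H (hasLeft c) (hasDown c) (nonLefts c))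

  byArrows : (q p f : ℕ → Carrier) → Bool → Bool → ℕ → Carrier
  byArrows q p f l d e = if d then f e else (if l then p e else q e)

  byArrows-left : ∀ q p f l d e → byArrows q p f true d e ≡ byArrows p p f l d e
  byArrows-left q p f true  d e = ≡.refl
  byArrows-left q p f false d e = ≡.refl

  columnSum-byArrows : ∀ n (q p f : ℕ → Carrier) → columnSum (byArrows q p f) n ≈ q n + (V p n + W f n)
  columnSum-byArrows zero    q p f = trans (+-identityʳ _) (sym (trans (+-congˡ (+-identityʳ _)) (+-identityʳ _)))
  columnSum-byArrows (suc n) q p f = begin
    columnSum (byArrows q p f) (suc n)
      ≈⟨ ∑-allVecs-suc allCells n _ ⟩
    columnSum (byArrows (q ∘ suc) (p ∘ suc) (f ∘ suc)) n
      + (∑ cols (λ c → [ validColumn c ]· byArrows q p f true (hasDown c) (nonLefts c))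
      + (∑ cols (λ c → [ allEmpty c ∧ validColumn c ]· f (suc (nonLefts c))) + 0#))
      ≈⟨ +-cong (columnSum-byArrows n (q ∘ suc) (p ∘ suc) (f ∘ suc))
                (+-cong (trans (∑-cong cols (λ c → reflexive (≡.cong [ validColumn c ]·_
                                   (byArrows-left q p f (hasLeft c) (hasDown c) (nonLefts c)))))
                               (columnSum-byArrows n p p f))
                        (trans (+-identityʳ _) downTop)) ⟩
    (q (suc n) + (V (p ∘ suc) n + W (f ∘ suc) n)) + ((p n + (V p n + W f n)) + f (suc n))
      ≈⟨ solve 7 (λ q₁ v₁ w₁ p₀ v w f₁ → (q₁ :+ (v₁ :+ w₁)) :+ ((p₀ :+ (v :+ w)) :+ f₁)
                                         := q₁ :+ ((v₁ :+ v :+ p₀) :+ (f₁ :+ w₁ :+ w))) refl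
           (q (suc n)) (V (p ∘ suc) n) (W (f ∘ suc) n) (p n) (V p n) (W f n) (f (suc n)) ⟩
    q (suc n) + (V p (suc n) + W f (suc n)) ∎
    where
    cols = allVecs allCells n
    downTop : ∑ cols (λ c → [ allEmpty c ∧ validColumn c ]· f (suc (nonLefts c))) ≈ f (suc n)
    downTop = begin
      ∑ cols (λ c → [ allEmpty c ∧ validColumn c ]· f (suc (nonLefts c)))
        ≈⟨ ∑-cong cols (λ c → reflexive ([]·-∧ (allEmpty c) (validColumn c) (f (suc (nonLefts c))))) ⟩
      ∑ cols (λ c → [ allEmpty c ]· [ validColumn c ]· f (suc (nonLefts c)))
        ≈⟨ ∑-allEmpty n (λ c → [ validColumn c ]· f (suc (nonLefts c))) ⟩
      [ validColumn (emptyRow n) ]· f (suc (nonLefts (emptyRow n)))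
        ≡⟨ ≡.cong₂ (λ v e → [ v ]· f (suc e)) (validColumn-emptyRow n) (nonLefts-emptyRow n) ⟩
      f (suc n) ∎

  fromℕ≡×1# : ∀ m → fromℕ m ≡ m × 1#
  fromℕ≡×1# zero    = ≡.refl
  fromℕ≡×1# (suc m) = ≡.cong (1# +_) (fromℕ≡×1# m)

  fromℕ-+ : ∀ a b → fromℕ (a ℕ.+ b) ≈ fromℕ a + fromℕ b
  fromℕ-+ a b rewrite fromℕ≡×1# (a ℕ.+ b) | fromℕ≡×1# a | fromℕ≡×1# b = ×-homo-+ 1# a b

  fromℕ-* : ∀ a b → fromℕ (a ℕ.* b) ≈ fromℕ a * fromℕ b
  fromℕ-* a b rewrite fromℕ≡×1# (a ℕ.* b) | fromℕ≡×1# a | fromℕ≡×1# b = ×1-homo-* a b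

  module _ (h : ℕ → Carrier) (h-0 : h 0 ≈ 0#) (h-+ : ∀ a b → h (a ℕ.+ b) ≈ h a + h b) where

    V-homo : ∀ n {p : ℕ → Carrier} {g : ℕ → ℕ} → (∀ e → p e ≈ h (g e)) → V p n ≈ h (StirlingSums.V g n)
    V-homo zero    p≈hg = sym h-0
    V-homo (suc n) {g = g} p≈hg = trans
      (+-cong (+-cong (V-homo n (p≈hg ∘ suc)) (V-homo n p≈hg)) (p≈hg n))
      (sym (trans (h-+ _ (g n)) (+-congʳ (h-+ _ _))))

    W-homo : ∀ n {f : ℕ → Carrier} {g : ℕ → ℕ} → (∀ e → f e ≈ h (g e)) → W f n ≈ h (StirlingSums.W g n)
    W-homo zero    f≈hg = sym h-0
    W-homo (suc n) {g = g} f≈hg = trans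
      (+-cong (+-cong (f≈hg (suc n)) (W-homo n (f≈hg ∘ suc))) (W-homo n f≈hg))
      (sym (trans (h-+ _ _) (+-congʳ (h-+ (g (suc n)) _))))

  scale-+ : ∀ k a b → k * fromℕ (a ℕ.+ b) ≈ k * fromℕ a + k * fromℕ b
  scale-+ k a b = trans (*-congˡ (fromℕ-+ a b)) (distribˡ k _ _)

  ∑-upTo-suc : ∀ N (f : ℕ → Carrier) → ∑ (upTo (suc N)) f ≈ f 0 + ∑ (upTo N) (f ∘ suc)
  ∑-upTo-suc N f =
    +-congˡ (trans (reflexive (≡.cong (λ js → ∑ js f) (≡.sym (map-upTo suc N)))) (∑-map suc (upTo N) f))

  ∑-upTo-∷ʳ : ∀ N (f : ℕ → Carrier) → ∑ (upTo (suc N)) f ≈ ∑ (upTo N) f + f N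
  ∑-upTo-∷ʳ N f = begin
    ∑ (upTo (suc N)) f          ≡⟨ ≡.cong (λ js → ∑ js f) (upTo-∷ʳ N) ⟨
    ∑ (upTo N ++ [ N ]) f       ≈⟨ ∑-++ (upTo N) [ N ] f ⟩
    ∑ (upTo N) f + (f N + 0#)   ≈⟨ +-congˡ (+-identityʳ _) ⟩
    ∑ (upTo N) f + f N          ∎

  ∑-upTo-vanishing : ∀ {M N} → M ℕ.≤ N → (f : ℕ → Carrier) → (∀ j → M ℕ.≤ j → f j ≈ 0#) →
                     ∑ (upTo N) f ≈ ∑ (upTo M) f
  ∑-upTo-vanishing {N = zero}  ℕ.z≤n f f≈0 = refl
  ∑-upTo-vanishing {M} {suc N} M≤1+N f f≈0 with ℕ.m≤n⇒m<n∨m≡n M≤1+N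
  ... | inj₂ ≡.refl         = refl
  ... | inj₁ (ℕ.s≤s M≤N) = begin
    ∑ (upTo (suc N)) f   ≈⟨ ∑-upTo-∷ʳ N f ⟩
    ∑ (upTo N) f + f N   ≈⟨ +-cong (∑-upTo-vanishing M≤N f f≈0) (f≈0 N M≤N) ⟩
    ∑ (upTo M) f + 0#    ≈⟨ +-identityʳ _ ⟩
    ∑ (upTo M) f         ∎

  fromℕ-S-vanish : ∀ {m j} → m ℕ.< j → fromℕ (S m j) ≈ 0#
  fromℕ-S-vanish m<j = reflexive (≡.cong fromℕ (StirlingSums.S-vanish m<j))

  ∑-stirling-recurrence : ∀ k (b : ℕ → Carrier) →
    ∑ (upTo (suc k)) (λ j → fromℕ (S (suc k) (suc j)) * (fromℕ (suc j) * b j + b (suc j)))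
    ≈ ∑ (upTo (suc (suc k))) (λ j → fromℕ (S (suc (suc k)) (suc j)) * b j)
  ∑-stirling-recurrence k b = sym (begin
    ∑ (upTo (suc (suc k))) (λ j → fromℕ (S (suc (suc k)) (suc j)) * b j)
      ≈⟨ ∑-cong (upTo (suc (suc k))) (λ j → trans
           (*-congʳ (trans (fromℕ-+ (suc j ℕ.* S (suc k) (suc j)) (S (suc k) j))
                           (+-congʳ (fromℕ-* (suc j) (S (suc k) (suc j))))))
           (distribʳ (b j) (fromℕ (suc j) * s j) (fromℕ (S (suc k) j)))) ⟩
    ∑ (upTo (suc (suc k))) (λ j → fromℕ (suc j) * s j * b j + fromℕ (S (suc k) j) * b j)
      ≈⟨ ∑-+ (upTo (suc (suc k))) (λ j → fromℕ (suc j) * s j * b j) (λ j → fromℕ (S (suc k) j) * b j) ⟩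
    ∑ (upTo (suc (suc k))) (λ j → fromℕ (suc j) * s j * b j)
      + ∑ (upTo (suc (suc k))) (λ j → fromℕ (S (suc k) j) * b j)
      ≈⟨ +-cong (trans (∑-upTo-∷ʳ (suc k) (λ j → fromℕ (suc j) * s j * b j))
                       (trans (+-congˡ lastVanishes) (+-identityʳ _)))
                (trans (∑-upTo-suc (suc k) (λ j → fromℕ (S (suc k) j) * b j))
                       (trans (+-congʳ (zeroˡ (b 0))) (+-identityˡ _))) ⟩
    ∑ (upTo (suc k)) (λ j → fromℕ (suc j) * s j * b j) + ∑ (upTo (suc k)) (λ j → s j * b (suc j))
      ≈⟨ ∑-+ (upTo (suc k)) (λ j → fromℕ (suc j) * s j * b j) (λ j → s j * b (suc j)) ⟨
    ∑ (upTo (suc k)) (λ j → fromℕ (suc j) * s j * b j + s j * b (suc j))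
      ≈⟨ ∑-cong (upTo (suc k)) (λ j →
           solve 4 (λ a s b b′ → a :* s :* b :+ s :* b′ := s :* (a :* b :+ b′)) refl
                   (fromℕ (suc j)) (s j) (b j) (b (suc j))) ⟩
    ∑ (upTo (suc k)) (λ j → s j * (fromℕ (suc j) * b j + b (suc j))) ∎)
    where
    s : ℕ → Carrier
    s j = fromℕ (S (suc k) (suc j))
    lastVanishes : fromℕ (suc (suc k)) * s (suc k) * b (suc k) ≈ 0#
    lastVanishes = trans (*-congʳ (trans (*-congˡ (fromℕ-S-vanish (ℕ.n<1+n (suc k)))) (zeroʳ _))) (zeroˡ _)

  fromℕ-1 : fromℕ 1 ≈ 1#
  fromℕ-1 = +-identityʳ 1#

module Enumeration {c ℓ} (R : CommutativeSemiring c ℓ) (x : CommutativeSemiring.Carrier R) where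

  open import Function using (_∘_)
  open import Data.Bool using (true; false; _∧_; not; if_then_else_)
  import Data.Bool as Bool
  open import Data.Nat as ℕ using (zero; suc; _!)
  open import Data.List using (List; []; _∷_; allFin; filter; upTo)
  open import Data.Vec using (Vec; []; _∷_; replicate)
  import Relation.Binary.PropositionalEquality as ≡
  open Tableau
  open CommutativeSemiring R hiding (zero)
  open Poly R
  open ColumnSums _+_ 0#
  open SemiringSums R
  open import Algebra.Solver.Ring.NaturalCoefficients.Default R using (solve; _:=_; _:+_; _:*_)
  open import Relation.Binary.Reasoning.Setoid setoid

  tableauSum : ℕ → ℕ → Carrier
  tableauSum n k = ∑ (allFillings n k) (λ T → [ isAltTableau T ]· pow x (wLeft T))

  tableauPoly≈tableauSum : ∀ n k → tableauPoly n k x ≈ tableauSum n k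
  tableauPoly≈tableauSum n k = trans
    (reflexive (sumR-map (filter (λ T → isAltTableau T Bool.≟ true) (allFillings n k)) (λ T → pow x (wLeft T))))
    (∑-filter isAltTableau (allFillings n k) (λ T → pow x (wLeft T)))

  pow-+ : ∀ a b → pow x (a ℕ.+ b) ≈ pow x a * pow x b
  pow-+ zero    b = sym (*-identityˡ _)
  pow-+ (suc a) b = trans (*-congˡ (pow-+ a b)) (sym (*-assoc _ _ _))

  columnWeight : ∀ {n} → Vec Cell n → Carrier
  columnWeight c = if leftNoDown c then x else 1#

  pow-wLeft-snoc : ∀ {n k} (T : Filling n k) c → pow x (wLeft (snocColumn T c)) ≈ columnWeight c * pow x (wLeft T)
  pow-wLeft-snoc T c with leftNoDown c | wLeft-snoc T c
  ... | true  | eq = trans (reflexive (≡.cong (pow x) eq))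
                           (trans (pow-+ (wLeft T) 1) (trans (*-congˡ (*-identityʳ x)) (*-comm _ x)))
  ... | false | eq = trans (reflexive (≡.cong (pow x) eq))
                           (trans (pow-+ (wLeft T) 0) (trans (*-identityʳ _) (sym (*-identityˡ _))))

  columnOperator : (ℕ → Carrier) → ℕ → Carrier
  columnOperator f n = ∑ (allVecs allCells n) (λ c → [ validColumn c ]· (columnWeight c * f (nonLefts c)))

  tableauSum-suc : ∀ n k → tableauSum n (suc k) ≈ columnOperator (λ m → tableauSum m k) n
  tableauSum-suc n k = begin
    tableauSum n (suc k)
      ≈⟨ ∑-allFillings-snoc n k _ ⟩
    ∑ (allFillings n k) (λ T → ∑ cols (λ c → [ isAltTableau (snocColumn T c) ]· pow x (wLeft (snocColumn T c))))
      ≈⟨ ∑-swap (allFillings n k) cols _ ⟩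
    ∑ cols (λ c → ∑ (allFillings n k) (λ T → [ isAltTableau (snocColumn T c) ]· pow x (wLeft (snocColumn T c))))
      ≈⟨ ∑-cong cols (λ c → ∑-cong (allFillings n k) (separate c)) ⟩
    ∑ cols (λ c → ∑ (allFillings n k) (λ T → [ validColumn c ]· (columnWeight c * [ emptyAtLefts T c ]· term T)))
      ≈⟨ ∑-cong cols (λ c → trans (∑-[]· (allFillings n k) (validColumn c) _)
           ([]·-cong (validColumn c) (trans (∑-*ˡ (allFillings n k) _ _)
             (*-congˡ (∑-emptyAtLefts k c term))))) ⟩
    ∑ cols (λ c → [ validColumn c ]· (columnWeight c * ∑ (allFillings (nonLefts c) k) (term ∘ insertEmptyRows c)))
      ≈⟨ ∑-cong cols (λ c → []·-cong (validColumn c) (*-congˡ (∑-cong (allFillings (nonLefts c) k)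
           (λ T → reflexive (≡.cong₂ (λ a w → [ a ]· pow x w)
                         (isAltTableau-insertEmptyRows c T) (wLeft-insertEmptyRows c T)))))) ⟩
    columnOperator (λ m → tableauSum m k) n ∎
    where
    cols = allVecs allCells n
    term : ∀ {m} → Filling m k → Carrier
    term T = [ isAltTableau T ]· pow x (wLeft T)
    separate : ∀ c T → [ isAltTableau (snocColumn T c) ]· pow x (wLeft (snocColumn T c))
                     ≈ [ validColumn c ]· (columnWeight c * [ emptyAtLefts T c ]· term T)
    separate c T = begin
      [ isAltTableau (snocColumn T c) ]· pow x (wLeft (snocColumn T c))
        ≈⟨ []·-cong (isAltTableau (snocColumn T c)) (pow-wLeft-snoc T c) ⟩
      [ isAltTableau (snocColumn T c) ]· (columnWeight c * pow x (wLeft T))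
        ≡⟨ ≡.cong (λ a → [ a ]· (columnWeight c * pow x (wLeft T))) (isAltTableau-snoc T c) ⟩
      [ isAltTableau T ∧ (validColumn c ∧ emptyAtLefts T c) ]· (columnWeight c * pow x (wLeft T))
        ≈⟨ regroup (isAltTableau T) (validColumn c) (emptyAtLefts T c) ⟩
      [ validColumn c ]· (columnWeight c * [ emptyAtLefts T c ]· term T) ∎
      where
      regroup : ∀ a v e → [ a ∧ (v ∧ e) ]· (columnWeight c * pow x (wLeft T))
                        ≈ [ v ]· (columnWeight c * [ e ]· [ a ]· pow x (wLeft T))
      regroup true  true  true  = refl
      regroup true  true  false = sym (zeroʳ _)
      regroup true  false e     = refl
      regroup false true  true  = sym (zeroʳ _)
      regroup false true  false = sym (zeroʳ _)
      regroup false false e     = refl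

  columnOperator-closed : ∀ n (f : ℕ → Carrier) → columnOperator f n ≈ f n + (V (λ e → x * f e) n + W f n)
  columnOperator-closed n f = trans
    (∑-cong (allVecs allCells n) (λ c → []·-cong (validColumn c) (weigh (hasLeft c) (hasDown c) (nonLefts c))))
    (columnSum-byArrows n f (λ e → x * f e) f)
    where
    weigh : ∀ l d e → (if l ∧ not d then x else 1#) * f e ≈ byArrows f (λ e → x * f e) f l d e
    weigh true  true  e = *-identityˡ _
    weigh true  false e = refl
    weigh false true  e = *-identityˡ _
    weigh false false e = *-identityˡ _

  β : ℕ → ℕ → Carrier
  β j m = fromℕ (j !) * rising x j * fromℕ (S (suc m) (suc j))

  columnOperator-β : ∀ j n → columnOperator (β j) n ≈ fromℕ (suc j) * β j n + β (suc j) n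
  columnOperator-β j n = begin
    columnOperator (β j) n
      ≈⟨ columnOperator-closed n (β j) ⟩
    β j n + (V (λ e → x * β j e) n + W (β j) n)
      ≈⟨ +-congˡ (+-comm _ _) ⟩
    β j n + (W (β j) n + V (λ e → x * β j e) n)
      ≈⟨ +-assoc _ _ _ ⟨
    (β j n + W (β j) n) + V (λ e → x * β j e) n
      ≈⟨ +-cong (trans (+-comm _ _) W-part) V-part ⟩
    K * (a * S₁ + a * a * S₂) + x * K * (a * S₂)
      ≈⟨ solve 6 (λ F ρ x a A B → F :* ρ :* (a :* B :+ a :* a :* A) :+ x :* (F :* ρ) :* (a :* A)
                                 := a :* (F :* ρ :* B) :+ (a :* F) :* (ρ :* (x :+ a)) :* A) refl
           (fromℕ (j !)) (rising x j) x a S₂ S₁ ⟩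
    a * β j n + (a * fromℕ (j !)) * rising x (suc j) * S₂
      ≈⟨ +-congˡ (*-congʳ (*-congʳ (fromℕ-* (suc j) (j !)))) ⟨
    a * β j n + β (suc j) n ∎
    where
    K = fromℕ (j !) * rising x j
    a = fromℕ (suc j)
    S₂ = fromℕ (S (suc n) (suc (suc j)))
    S₁ = fromℕ (S (suc n) (suc j))
    V-part : V (λ e → x * β j e) n ≈ x * K * (a * S₂)
    V-part = begin
      V (λ e → x * β j e) n
        ≈⟨ V-homo (λ m → x * K * fromℕ m) (zeroʳ _) (scale-+ (x * K)) n (λ e → sym (*-assoc x K _)) ⟩
      x * K * fromℕ (StirlingSums.V (λ m → S (suc m) (suc j)) n)
        ≡⟨ ≡.cong (λ m → x * K * fromℕ m) (StirlingSums.V-stirling n (suc j)) ⟩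
      x * K * fromℕ (suc j ℕ.* S (suc n) (suc (suc j)))
        ≈⟨ *-congˡ (fromℕ-* (suc j) (S (suc n) (suc (suc j)))) ⟩
      x * K * (a * S₂) ∎
    W-part : W (β j) n + β j n ≈ K * (a * S₁ + a * a * S₂)
    W-part = begin
      W (β j) n + K * S₁
        ≈⟨ +-congʳ (W-homo (λ m → K * fromℕ m) (zeroʳ _) (scale-+ K) n (λ e → refl)) ⟩
      K * fromℕ (StirlingSums.W (λ m → S (suc m) (suc j)) n) + K * S₁
        ≈⟨ scale-+ K (StirlingSums.W (λ m → S (suc m) (suc j)) n) (S (suc n) (suc j)) ⟨
      K * fromℕ (StirlingSums.W (λ m → S (suc m) (suc j)) n ℕ.+ S (suc n) (suc j))
        ≡⟨ ≡.cong (λ m → K * fromℕ m) (StirlingSums.W-stirling n (suc j)) ⟩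
      K * fromℕ (suc j ℕ.* S (suc n) (suc j) ℕ.+ suc j ℕ.* suc j ℕ.* S (suc n) (suc (suc j)))
        ≈⟨ *-congˡ (trans (fromℕ-+ (suc j ℕ.* S (suc n) (suc j)) (suc j ℕ.* suc j ℕ.* S (suc n) (suc (suc j))))
             (+-cong (fromℕ-* (suc j) (S (suc n) (suc j)))
                     (trans (fromℕ-* (suc j ℕ.* suc j) (S (suc n) (suc (suc j))))
                            (*-congʳ (fromℕ-* (suc j) (suc j)))))) ⟩
      K * (a * S₁ + a * a * S₂) ∎

  columnOperator-cong : ∀ n {f g : ℕ → Carrier} → (∀ m → f m ≈ g m) → columnOperator f n ≈ columnOperator g n
  columnOperator-cong n f≈g =
    ∑-cong (allVecs allCells n) (λ c → []·-cong (validColumn c) (*-congˡ (f≈g (nonLefts c))))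

  columnOperator-0# : ∀ n → columnOperator (λ _ → 0#) n ≈ 0#
  columnOperator-0# n = trans
    (∑-cong (allVecs allCells n) (λ c → trans ([]·-cong (validColumn c) (zeroʳ _)) ([]·-0# (validColumn c))))
    (∑-0# (allVecs allCells n))

  columnOperator-+ : ∀ n (f g : ℕ → Carrier) →
                     columnOperator (λ m → f m + g m) n ≈ columnOperator f n + columnOperator g n
  columnOperator-+ n f g = trans
    (∑-cong (allVecs allCells n) (λ c → trans ([]·-cong (validColumn c) (distribˡ _ _ _)) ([]·-+ (validColumn c) _ _)))
    (∑-+ (allVecs allCells n) _ _)

  columnOperator-*ˡ : ∀ n k (f : ℕ → Carrier) → columnOperator (λ m → k * f m) n ≈ k * columnOperator f n
  columnOperator-*ˡ n k f = trans
    (∑-cong (allVecs allCells n) (λ c →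
      trans ([]·-cong (validColumn c) (x∙yz≈y∙xz _ k _)) ([]·-*ˡ (validColumn c) k _)))
    (∑-*ˡ (allVecs allCells n) k _)
    where open import Algebra.Properties.CommutativeSemigroup *-commutativeSemigroup using (x∙yz≈y∙xz)

  columnOperator-∑ : ∀ n (js : List ℕ) (c : ℕ → Carrier) (h : ℕ → ℕ → Carrier) →
    columnOperator (λ m → ∑ js (λ j → c j * h j m)) n ≈ ∑ js (λ j → c j * columnOperator (h j) n)
  columnOperator-∑ n []       c h = columnOperator-0# n
  columnOperator-∑ n (j ∷ js) c h = trans
    (columnOperator-+ n (λ m → c j * h j m) (λ m → ∑ js (λ j → c j * h j m)))
    (+-cong (columnOperator-*ˡ n (c j) (h j)) (columnOperator-∑ n js c h))

  tableauSum-zero : ∀ m → tableauSum m 0 ≈ 1#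
  tableauSum-zero m = trans (∑-singleton m _) (reflexive (≡.cong ([_]· 1#) (all-const-true (allFin m))))
    where
    ∑-singleton : ∀ m (g : Filling m 0 → Carrier) → ∑ (allFillings m 0) g ≈ g (replicate m [])
    ∑-singleton zero    g = +-identityʳ _
    ∑-singleton (suc m) g =
      trans (∑-allVecs-suc ([] ∷ []) m g) (trans (+-identityʳ _) (∑-singleton m (g ∘ ([] ∷_))))

  β-zero : ∀ m → β 0 m ≈ 1#
  β-zero m = trans
    (*-cong (trans (*-identityʳ _) fromℕ-1) (trans (reflexive (≡.cong fromℕ (StirlingSums.S-suc-1 m))) fromℕ-1))
    (*-identityˡ 1#)

  tableauSum-expansion : ∀ k m → tableauSum m k ≈ ∑ (upTo (suc k)) (λ j → fromℕ (S (suc k) (suc j)) * β j m)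
  tableauSum-expansion zero    m = begin
    tableauSum m 0                                ≈⟨ tableauSum-zero m ⟩
    1#                                            ≈⟨ *-identityˡ 1# ⟨
    1# * 1#                                       ≈⟨ *-cong fromℕ-1 (β-zero m) ⟨
    fromℕ 1 * β 0 m                               ≈⟨ +-identityʳ _ ⟨
    fromℕ 1 * β 0 m + 0#                          ∎
  tableauSum-expansion (suc k) m = begin
    tableauSum m (suc k)
      ≈⟨ tableauSum-suc m k ⟩
    columnOperator (λ m′ → tableauSum m′ k) m
      ≈⟨ columnOperator-cong m (tableauSum-expansion k) ⟩
    columnOperator (λ m′ → ∑ (upTo (suc k)) (λ j → fromℕ (S (suc k) (suc j)) * β j m′)) m
      ≈⟨ columnOperator-∑ m (upTo (suc k)) (λ j → fromℕ (S (suc k) (suc j))) β ⟩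
    ∑ (upTo (suc k)) (λ j → fromℕ (S (suc k) (suc j)) * columnOperator (β j) m)
      ≈⟨ ∑-cong (upTo (suc k)) (λ j → *-congˡ (columnOperator-β j m)) ⟩
    ∑ (upTo (suc k)) (λ j → fromℕ (S (suc k) (suc j)) * (fromℕ (suc j) * β j m + β (suc j) m))
      ≈⟨ ∑-stirling-recurrence k (λ j → β j m) ⟩
    ∑ (upTo (suc (suc k))) (λ j → fromℕ (S (suc (suc k)) (suc j)) * β j m) ∎

theorem3p1 : ∀ {c ℓ} (R : CommutativeSemiring c ℓ) (n k : ℕ) (x : CommutativeSemiring.Carrier R) →
    CommutativeSemiring._≈_ R (Poly.tableauPoly R n k x) (Poly.Bhat R n k x)
theorem3p1 R n k x = begin
  tableauPoly n k x
    ≈⟨ tableauPoly≈tableauSum n k ⟩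
  tableauSum n k
    ≈⟨ tableauSum-expansion k n ⟩
  ∑ (upTo (suc k)) (λ j → fromℕ (S (suc k) (suc j)) * β j n)
    ≈⟨ ∑-cong (upTo (suc k)) regroup ⟩
  ∑ (upTo (suc k)) term
    ≈⟨ ∑-upTo-vanishing (ℕ.s≤s (ℕ.m⊓n≤n n k)) term vanish ⟩
  ∑ (upTo (suc (n ⊓ k))) term
    ≡⟨ ≡.sym (sumR-map (upTo (suc (n ⊓ k))) term) ⟩
  Bhat n k x ∎
  where
  open import Data.Nat as ℕ using (suc; _⊓_; _!)
  import Data.Nat.Properties as ℕ
  open import Data.List using (upTo)
  import Relation.Binary.PropositionalEquality as ≡
  open CommutativeSemiring R
  open Poly R
  open SemiringSums R
  open Enumeration R x
  open import Relation.Binary.Reasoning.Setoid setoid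
  open import Algebra.Solver.Ring.NaturalCoefficients.Default R using (solve; _:=_; _:*_)
  term : ℕ → Carrier
  term j = fromℕ (j !) * rising x j * fromℕ (S (suc n) (suc j) ℕ.* S (suc k) (suc j))
  regroup : ∀ j → fromℕ (S (suc k) (suc j)) * β j n ≈ term j
  regroup j = trans
    (solve 4 (λ s F ρ t → s :* (F :* ρ :* t) := F :* ρ :* (t :* s)) refl
             (fromℕ (S (suc k) (suc j))) (fromℕ (j !)) (rising x j) (fromℕ (S (suc n) (suc j))))
    (*-congˡ (sym (fromℕ-* (S (suc n) (suc j)) (S (suc k) (suc j)))))
  vanish : ∀ j → suc (n ⊓ k) ℕ.≤ j → term j ≈ 0#
  vanish j n⊓k<j = trans (*-congˡ (reflexive (≡.cong fromℕ (StirlingSums.S-product-vanish n k n⊓k<j)))) (zeroʳ _)
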